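{- Let $\mathbf B$ be an involutive bisemilattice, identified with its Płonka sum representation over the semilattice direct system $\langle\{\mathbf A_i\}_{i\in I},I,p_{ij}\rangle$ of Boolean algebras, and let $s\colon B\to[0,1]$ be a map. The following are equivalent: (1) $s$ is a state over $\mathbf B$; (2) for every $i\in I$ the restriction $s_i$ of $s$ to $A_i$ is a finitely additive probability measure on $\mathbf A_i$, and for all $i\le j$ in $I$ the homomorphism $p_{ij}$ preserves the measures, i.e. $s_j(p_{ij}(a))=s_i(a)$ for all $a\in A_i$.
   Context: An involutive bisemilattice is an algebra $\mathbf B=\langle B,\wedge,\vee,',0,1\rangle$ of type $(2,2,1,0,0)$ satisfying $x\vee x\approx x$, $x\vee y\approx y\vee x$, $x\vee(y\vee z)\approx(x\vee y)\vee z$, $(x')'\approx x$, $x\wedge y\approx(x'\vee y')'$, $x\wedge(x'\vee y)\approx x\wedge y$, $0\vee x\approx x$, $1\approx 0'$. Every involutive bisemilattice is (canonically) the Płonka sum of a semilattice direct system of Boolean algebras, and $\mathbf B$ is identified with it: there is a join-semilattice $(I,\vee)$ with least element $i_0$ (ordered by $i\le j$ iff $i\vee j=j$), Boolean algebras $\mathbf A_i$ ($i\in I$) with pairwise disjoint universes, and Boolean homomorphisms $p_{ij}\colon\mathbf A_i\to\mathbf A_j$ for $i\le j$, with $p_{ii}=\mathrm{id}$ and $p_{ik}=p_{jk}\circ p_{ij}$ for $i\le j\le k$, such that $B=\bigsqcup_{i\in I}A_i$; for $a\in A_i$, $b\in A_j$ and $k=i\vee j$, $a\wedge b=p_{ik}(a)\wedge^{\mathbf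 A_k}p_{jk}(b)$ and $a\vee b=p_{ik}(a)\vee^{\mathbf A_k}p_{jk}(b)$; $a'$ is the complement of $a$ in the algebra $\mathbf A_i$ containing $a$; and $0,1$ are the bottom and top of $\mathbf A_{i_0}$. We write $0_i,1_i$ for the bottom and top of $\mathbf A_i$. A state over $\mathbf B$ is a map $s\colon B\to[0,1]$ such that $s(1)=1$ and $s(a\vee b)=s(a)+s(b)$ whenever $a\wedge b\in\{0_i:i\in I\}$. A finitely additive probability measure on a Boolean algebra $\mathbf A$ is a map $m\colon A\to[0,1]$ with $m(1)=1$ and $m(a\vee b)=m(a)+m(b)$ whenever $a\wedge b=0$. -}

module Defs where

open import Level using (0ℓ) renaming (suc to lsuc)
open import Data.Product using (Σ; Σ-syntax; ∃; _×_; _,_; proj₁; proj₂)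
open import Relation.Binary.PropositionalEquality using (_≡_; sym; trans; cong)
open import Relation.Binary.Structures using (IsTotalOrder)
open import Relation.Nullary using (¬_)
open import Algebra.Structures using (IsCommutativeRing; IsCommutativeBand)
open import Algebra.Lattice.Structures using (IsSemilattice)
open import Algebra.Lattice.Bundles using (BooleanAlgebra)

-- The real numbers, axiomatised as a (Dedekind-)complete ordered field.
-- The stdlib has no reals; every such structure is (classically)
-- isomorphic to ℝ, and the theorem is stated for an arbitrary one.

record Reals : Set₁ where
  infixl 6 _+_
  infixl 7 _*_
  infix  4 _≤_
  field
    ℝ     : Set
    _+_   : ℝ → ℝ → ℝ
    _*_   : ℝ → ℝ → ℝ
    -_    : ℝ → ℝ
    0r 1r : ℝ
    _≤_   : ℝ → ℝ → Set
    isCommutativeRing : IsCommutativeRing _≡_ _+_ _*_ -_ 0r 1r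
    0≢1   : ¬ (0r ≡ 1r)
    inverse : ∀ x → ¬ (x ≡ 0r) → Σ[ y ∈ ℝ ] (x * y ≡ 1r)
    isTotalOrder : IsTotalOrder _≡_ _≤_
    +-mono-≤ : ∀ {x y} z → x ≤ y → x + z ≤ y + z
    *-nonneg : ∀ {x y} → 0r ≤ x → 0r ≤ y → 0r ≤ x * y
    complete : (P : ℝ → Set) → Σ[ x ∈ ℝ ] P x →
               Σ[ b ∈ ℝ ] (∀ x → P x → x ≤ b) →
               Σ[ u ∈ ℝ ] ((∀ x → P x → x ≤ u) ×
                           (∀ b → (∀ x → P x → x ≤ b) → u ≤ b))

  UnitInterval : Set
  UnitInterval = Σ[ x ∈ ℝ ] (0r ≤ x × x ≤ 1r)

BA : Set₁
BA = BooleanAlgebra 0ℓ 0ℓ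

record IsBoolHom (A B : BA) (f : BooleanAlgebra.Carrier A → BooleanAlgebra.Carrier B) : Set where
  private
    module A = BooleanAlgebra A
    module B = BooleanAlgebra B
  field
    f-cong : ∀ {x y} → x A.≈ y → f x B.≈ f y
    ∨-hom : ∀ x y → f (x A.∨ y) B.≈ (f x B.∨ f y)
    ∧-hom : ∀ x y → f (x A.∧ y) B.≈ (f x B.∧ f y)
    ¬-hom : ∀ x → f (A.¬ x) B.≈ (B.¬ (f x))
    ⊤-hom : f A.⊤ B.≈ B.⊤
    ⊥-hom : f A.⊥ B.≈ B.⊥

record DirectSystem : Set₁ where
  field
    I    : Set
    _⊔_  : I → I → I
    isSemilattice : IsSemilattice _≡_ _⊔_
    i₀   : I
    i₀-least : ∀ i → i₀ ⊔ i ≡ i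

  _≼_ : I → I → Set
  i ≼ j = i ⊔ j ≡ j

  field
    A    : I → BA
    p    : ∀ {i j} → i ≼ j → BooleanAlgebra.Carrier (A i) → BooleanAlgebra.Carrier (A j)
    p-hom : ∀ {i j} (i≼j : i ≼ j) → IsBoolHom (A i) (A j) (p i≼j)
    p-id  : ∀ {i} (i≼i : i ≼ i) a → BooleanAlgebra._≈_ (A i) (p i≼i a) a
    p-∘   : ∀ {i j k} (i≼j : i ≼ j) (j≼k : j ≼ k) (i≼k : i ≼ k) a →
            BooleanAlgebra._≈_ (A k) (p i≼k a) (p j≼k (p i≼j a))

  Car : I → Set
  Car i = BooleanAlgebra.Carrier (A i)

  open IsCommutativeBand isSemilattice using (assoc; comm; idem)

  ≼-⊔ˡ : ∀ i j → i ≼ (i ⊔ j)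
  ≼-⊔ˡ i j = trans (sym (assoc i i j)) (cong (_⊔ j) (idem i))

  ≼-⊔ʳ : ∀ i j → j ≼ (i ⊔ j)
  ≼-⊔ʳ i j = trans (cong (j ⊔_) (comm i j)) (trans (≼-⊔ˡ j i) (comm j i))

  B : Set
  B = Σ[ i ∈ I ] Car i

  infixr 7 _∧B_
  infixr 6 _∨B_

  _∧B_ : B → B → B
  (i , a) ∧B (j , b) = (i ⊔ j) , BooleanAlgebra._∧_ (A (i ⊔ j)) (p (≼-⊔ˡ i j) a) (p (≼-⊔ʳ i j) b)

  _∨B_ : B → B → B
  (i , a) ∨B (j , b) = (i ⊔ j) , BooleanAlgebra._∨_ (A (i ⊔ j)) (p (≼-⊔ˡ i j) a) (p (≼-⊔ʳ i j) b)

  _′ : B → B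
  (i , a) ′ = i , BooleanAlgebra.¬_ (A i) a

  0B 1B : B
  0B = i₀ , BooleanAlgebra.⊥ (A i₀)
  1B = i₀ , BooleanAlgebra.⊤ (A i₀)

  0ᵢ 1ᵢ : (i : I) → B
  0ᵢ i = i , BooleanAlgebra.⊥ (A i)
  1ᵢ i = i , BooleanAlgebra.⊤ (A i)

  IsSomeZero : B → Set
  IsSomeZero (i , a) = BooleanAlgebra._≈_ (A i) a (BooleanAlgebra.⊥ (A i))

module _ (R : Reals) (D : DirectSystem) where
  open Reals R
  open DirectSystem D

  RespectsEq : (B → UnitInterval) → Set
  RespectsEq s = ∀ i {a b : Car i} → BooleanAlgebra._≈_ (A i) a b →
                 proj₁ (s (i , a)) ≡ proj₁ (s (i , b))

  IsState : (B → UnitInterval) → Set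
  IsState s = (proj₁ (s 1B) ≡ 1r) ×
              (∀ x y → IsSomeZero (x ∧B y) →
                 proj₁ (s (x ∨B y)) ≡ proj₁ (s x) + proj₁ (s y))

  IsFAPM : (Ab : BA) → (BooleanAlgebra.Carrier Ab → UnitInterval) → Set
  IsFAPM Ab m = (proj₁ (m (BooleanAlgebra.⊤ Ab)) ≡ 1r) ×
                (∀ a b → BooleanAlgebra._≈_ Ab (BooleanAlgebra._∧_ Ab a b) (BooleanAlgebra.⊥ Ab) →
                   proj₁ (m (BooleanAlgebra._∨_ Ab a b)) ≡ proj₁ (m a) + proj₁ (m b))

  restrict : (B → UnitInterval) → (i : I) → Car i → UnitInterval
  restrict s i a = s (i , a)

module Submission where

-- Everything rests on one observation: the operations of B applied to
-- (i , a) and (j , b) are computed in the summand A_{i⊔j}, and because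
-- p_{kk} is the identity, that computation may be carried out in any
-- summand A_k with i ⊔ j ≡ k (lemmas ∨B-at and ∧B-zero-at).
--   (⇐) For x ∈ Aᵢ, y ∈ Aⱼ, additivity of s on x ∨ y is additivity of
--       s_{i⊔j} on pᵢ(x) ∨ pⱼ(y) followed by preservation along pᵢ, pⱼ.
--   (⇒) Joining (i , a) with the zero 0ₖ of a larger summand gives
--       s(p_{ik} a) = s(a) + s(0ₖ) (lemma shift).  Taking a = 0ₖ shows
--       s(0ₖ) = 0, hence p_{ik} preserves s; normalisation of sᵢ follows
--       from 1ᵢ = p_{i₀i}(1), and additivity of sᵢ from joins inside Aᵢ.

open import Defs
open import Data.Product using (proj₁; proj₂; _×_; _,_)
open import Relation.Binary.PropositionalEquality
  using (_≡_; refl; sym; trans; cong; cong₂; module ≡-Reasoning)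
open import Function.Bundles using (_⇔_; mk⇔)
open import Level using (0ℓ)
open import Algebra.Bundles using (CommutativeRing)
open import Algebra.Lattice.Bundles using (BooleanAlgebra)
open import Algebra.Structures using (IsCommutativeBand; IsCommutativeRing)
import Algebra.Lattice.Properties.BooleanAlgebra as BooleanAlgebraProperties
import Algebra.Properties.Ring as RingProperties

-- In the reals, the only solution of x + x = x is 0; this is what forces
-- a state to vanish on every zero 0ₖ.
module _ (R : Reals) where
  open Reals R

  ℝ-commutativeRing : CommutativeRing 0ℓ 0ℓ
  ℝ-commutativeRing = record { isCommutativeRing = isCommutativeRing }

  x+x≡x⇒x≡0 : ∀ x → x + x ≡ x → x ≡ 0r
  x+x≡x⇒x≡0 = RingProperties.x+x≈x⇒x≈0 (CommutativeRing.ring ℝ-commutativeRing)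

module DirectSystemFacts (D : DirectSystem) where
  open DirectSystem D
  open IsCommutativeBand isSemilattice using (idem)

  -- The connecting map p_{ik} does not depend on the witness of i ≼ k:
  -- both are p_{kk} ∘ p_{ik} = p_{ik} by composition and identity.
  p-irrelevant : ∀ {i k} (h h′ : i ≼ k) a → BooleanAlgebra._≈_ (A k) (p h a) (p h′ a)
  p-irrelevant {k = k} h h′ a = Aₖ.trans (p-∘ h′ (idem k) h a) (p-id (idem k) (p h′ a))
    where module Aₖ = BooleanAlgebra (A k)

module MapFacts (R : Reals) (D : DirectSystem) (s : DirectSystem.B D → Reals.UnitInterval R)
                (resp : RespectsEq R D s) where
  open Reals R
  open DirectSystem D
  open DirectSystemFacts D
  open IsCommutativeBand isSemilattice using (idem)

  v : B → ℝ
  v x = proj₁ (s x)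

  ∨B-at : ∀ {i j k} (e : i ⊔ j ≡ k) (hi : i ≼ k) (hj : j ≼ k) a b →
          v ((i , a) ∨B (j , b)) ≡ v (k , BooleanAlgebra._∨_ (A k) (p hi a) (p hj b))
  ∨B-at {k = k} refl hi hj a b = resp k (Aₖ.∨-cong (p-irrelevant _ hi a) (p-irrelevant _ hj b))
    where module Aₖ = BooleanAlgebra (A k)

  ∧B-zero-at : ∀ {i j k} (e : i ⊔ j ≡ k) (hi : i ≼ k) (hj : j ≼ k) a b →
               BooleanAlgebra._≈_ (A k) (BooleanAlgebra._∧_ (A k) (p hi a) (p hj b))
                                        (BooleanAlgebra.⊥ (A k)) →
               IsSomeZero ((i , a) ∧B (j , b))
  ∧B-zero-at {k = k} refl hi hj a b disjoint =
    Aₖ.trans (Aₖ.∧-cong (p-irrelevant _ hi a) (p-irrelevant _ hj b)) disjoint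
    where module Aₖ = BooleanAlgebra (A k)

  module FromState (state : IsState R D s) where
    open IsCommutativeRing isCommutativeRing using (+-identityʳ)

    additive : ∀ x y → IsSomeZero (x ∧B y) → v (x ∨B y) ≡ v x + v y
    additive = proj₂ state

    shift : ∀ {i k} (h : i ≼ k) a → v (k , p h a) ≡ v (i , a) + v (0ᵢ k)
    shift {i} {k} h a = begin
      v (k , p h a)                 ≡⟨ resp k (Aₖ.sym absorb-⊥) ⟩
      v (k , p h a Aₖ.∨ p kk Aₖ.⊥)  ≡⟨ sym (∨B-at h h kk a Aₖ.⊥) ⟩
      v ((i , a) ∨B 0ᵢ k)           ≡⟨ additive (i , a) (0ᵢ k) (∧B-zero-at h h kk a Aₖ.⊥ disjoint) ⟩
      v (i , a) + v (0ᵢ k)          ∎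
      where
        open ≡-Reasoning
        module Aₖ = BooleanAlgebra (A k)
        module Pₖ = BooleanAlgebraProperties (A k)
        kk : k ≼ k
        kk = idem k
        absorb-⊥ : p h a Aₖ.∨ p kk Aₖ.⊥ Aₖ.≈ p h a
        absorb-⊥ = Aₖ.trans (Aₖ.∨-cong Aₖ.refl (p-id kk Aₖ.⊥)) (Pₖ.∨-identityʳ _)
        disjoint : p h a Aₖ.∧ p kk Aₖ.⊥ Aₖ.≈ Aₖ.⊥
        disjoint = Aₖ.trans (Aₖ.∧-cong Aₖ.refl (p-id kk Aₖ.⊥)) (Pₖ.∧-zeroʳ _)

    -- A state vanishes on every zero 0ₖ: shift with a = 0ₖ gives s(0ₖ) = 2 s(0ₖ).
    zero-null : ∀ k → v (0ᵢ k) ≡ 0r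
    zero-null k = x+x≡x⇒x≡0 R (v (0ᵢ k)) (begin
      v (0ᵢ k) + v (0ᵢ k)           ≡⟨ sym (shift (idem k) Aₖ.⊥) ⟩
      v (k , p (idem k) Aₖ.⊥)       ≡⟨ resp k (p-id (idem k) Aₖ.⊥) ⟩
      v (0ᵢ k)                      ∎)
      where
        open ≡-Reasoning
        module Aₖ = BooleanAlgebra (A k)

    preserves : ∀ {i k} (h : i ≼ k) a → v (k , p h a) ≡ v (i , a)
    preserves {i} {k} h a = begin
      v (k , p h a)         ≡⟨ shift h a ⟩
      v (i , a) + v (0ᵢ k)  ≡⟨ cong (v (i , a) +_) (zero-null k) ⟩
      v (i , a) + 0r        ≡⟨ +-identityʳ _ ⟩
      v (i , a)             ∎
      where open ≡-Reasoning

    -- sᵢ is normalised, since 1ᵢ = p_{i₀i}(1).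
    normalised : ∀ i → v (1ᵢ i) ≡ 1r
    normalised i = begin
      v (1ᵢ i)                   ≡⟨ resp i (Aᵢ.sym (IsBoolHom.⊤-hom (p-hom (i₀-least i)))) ⟩
      v (i , p (i₀-least i) ⊤₀)  ≡⟨ preserves (i₀-least i) ⊤₀ ⟩
      v 1B                       ≡⟨ proj₁ state ⟩
      1r                         ∎
      where
        open ≡-Reasoning
        module Aᵢ = BooleanAlgebra (A i)
        ⊤₀ : Car i₀
        ⊤₀ = BooleanAlgebra.⊤ (A i₀)

    -- sᵢ is additive, since joins inside Aᵢ are joins in B (computed in A_{i⊔i}).
    additive-within : ∀ i a b → BooleanAlgebra._≈_ (A i) (BooleanAlgebra._∧_ (A i) a b) (BooleanAlgebra.⊥ (A i)) →
                      v (i , BooleanAlgebra._∨_ (A i) a b) ≡ v (i , a) + v (i , b)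
    additive-within i a b disjoint = begin
      v (i , a Aᵢ.∨ b)              ≡⟨ resp i (Aᵢ.sym (Aᵢ.∨-cong (p-id ii a) (p-id ii b))) ⟩
      v (i , p ii a Aᵢ.∨ p ii b)    ≡⟨ sym (∨B-at ii ii ii a b) ⟩
      v ((i , a) ∨B (i , b))        ≡⟨ additive (i , a) (i , b) (∧B-zero-at ii ii ii a b disjoint′) ⟩
      v (i , a) + v (i , b)         ∎
      where
        open ≡-Reasoning
        module Aᵢ = BooleanAlgebra (A i)
        ii : i ≼ i
        ii = idem i
        disjoint′ : p ii a Aᵢ.∧ p ii b Aᵢ.≈ Aᵢ.⊥
        disjoint′ = Aᵢ.trans (Aᵢ.∧-cong (p-id ii a) (p-id ii b)) disjoint

    restrictions-are-measures : ∀ i → IsFAPM R D (A i) (restrict R D s i)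
    restrictions-are-measures i = normalised i , additive-within i

  -- (⇐) Compatible finitely additive probability measures glue to a state:
  -- a join in B is a join in A_{i⊔j} of the transported elements.
  state-from-measures : (∀ i → IsFAPM R D (A i) (restrict R D s i)) ×
                        (∀ {i j} (h : i ≼ j) a → v (j , p h a) ≡ v (i , a)) →
                        IsState R D s
  state-from-measures (measure , compatible) = proj₁ (measure i₀) , additive
    where
      additive : ∀ x y → IsSomeZero (x ∧B y) → v (x ∨B y) ≡ v x + v y
      additive (i , a) (j , b) disjoint =
        trans (proj₂ (measure (i ⊔ j)) _ _ disjoint)
              (cong₂ _+_ (compatible (≼-⊔ˡ i j) a) (compatible (≼-⊔ʳ i j) b))

proposition3p4 : (R : Reals) (D : DirectSystem) (s : DirectSystem.B D → Reals.UnitInterval R) →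
                 RespectsEq R D s →
                 IsState R D s ⇔
                 ((∀ i → IsFAPM R D (DirectSystem.A D i) (restrict R D s i)) ×
                  (∀ {i j} (i≼j : DirectSystem._≼_ D i j) (a : DirectSystem.Car D i) →
                     proj₁ (restrict R D s j (DirectSystem.p D i≼j a)) ≡ proj₁ (restrict R D s i a)))
proposition3p4 R D s resp =
  mk⇔ (λ state → restrictions-are-measures state , λ {i} {j} → preserves state {i} {j})
      state-from-measures
  where
    open MapFacts R D s resp
    open FromState using (restrictions-are-measures; preserves)
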